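{- There is a function $\operatorname{init}(c,d,k)$ such that the following holds. Let $c\geq1$, $d\geq 0$ be integers and $k$ a constant, let $H=(V,E)$ be a $(c,d)$-hypergraph and $\gamma\colon E\to[0,1]$ with $\operatorname{weight}(\gamma)\leq k$. Let $\mathbf{S}_0=\{\{e\}\mid e\in E,\ \gamma(e)\geq 1/(2c)\}$ and $U_0=B(\gamma)\setminus\bigcup\{e\in E\mid \gamma(e)\geq 1/(2c)\}$ (the initial pair). Then $n(\mathbf{S}_0,U_0)\leq \operatorname{init}(c,d,k)$.
   Context: A hypergraph $H=(V,E)$ has a finite vertex set $V$ and a set $E$ of non-empty subsets of $V$. $H$ is a $(c,d)$-hypergraph if any $c$ distinct edges have at most $d$ common vertices. For $\gamma\colon E\to[0,1]$, $B(\gamma)=\{v\in V\mid \sum_{e\ni v}\gamma(e)\geq1\}$ and $\operatorname{weight}(\gamma)=\sum_{e\in E}\gamma(e)$. For a finite collection $\mathbf{S}=\{S_1,\dots,S_r\}$ of sets of edges and a vertex set $U$, the size of the pair is $n(\mathbf{S},U)=\sum_{i\in[r]}|S_i|+2^{|U|}$.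
   Formalization: The function γ takes rational values in [0,1], and the constant k is rational. -}

module Defs where

open import Data.Nat using (ℕ; zero; suc; _*_; _^_) renaming (_≤_ to _≤ℕ_; _+_ to _+ℕ_)
open import Data.Integer using (+_)
open import Data.Rational using (ℚ; 0ℚ; 1ℚ; _/_; _+_; _≤_; _≤?_)
open import Data.Fin using (Fin; zero; suc)
open import Data.Fin.Subset using (Subset; inside; outside; ∣_∣; ⋂; _─_; Nonempty)
open import Data.Fin.Subset.Properties using (_∈?_)
open import Data.List using (List; []; _∷_; tabulate)
open import Data.Vec as Vec using ()
open import Data.Product using (_×_)
open import Function.Definitions using (Injective)
open import Relation.Binary.PropositionalEquality using (_≡_)
open import Relation.Nullary using (does)
open import Data.Bool using (if_then_else_)

-- A hypergraph on vertex set Fin n with m edges, edges indexed by Fin m.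
-- Edges are non-empty subsets of V and pairwise distinct (E is a set).
record Hypergraph (n m : ℕ) : Set where
  field
    edge     : Fin m → Subset n
    nonempty : ∀ e → Nonempty (edge e)
    distinct : Injective _≡_ _≡_ edge
open Hypergraph public

common : ∀ {n m c} → Hypergraph n m → (Fin c → Fin m) → Subset n
common H f = ⋂ (tabulate (λ i → edge H (f i)))

IsCD : ∀ {n m} → ℕ → ℕ → Hypergraph n m → Set
IsCD {m = m} c d H =
  (f : Fin c → Fin m) → Injective _≡_ _≡_ f → ∣ common H f ∣ ≤ℕ d

sumFin : ∀ {m} → (Fin m → ℚ) → ℚ
sumFin {zero}  g = 0ℚ
sumFin {suc m} g = g zero + sumFin (λ i → g (suc i))

IsFractional : ∀ {m} → (Fin m → ℚ) → Set
IsFractional γ = ∀ e → (0ℚ ≤ γ e) × (γ e ≤ 1ℚ)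

weight : ∀ {m} → (Fin m → ℚ) → ℚ
weight = sumFin

load : ∀ {n m} → Hypergraph n m → (Fin m → ℚ) → Fin n → ℚ
load H γ v = sumFin (λ e → if does (v ∈? edge H e) then γ e else 0ℚ)

B : ∀ {n m} → Hypergraph n m → (Fin m → ℚ) → Subset n
B H γ = Vec.tabulate (λ v → if does (1ℚ ≤? load H γ v) then inside else outside)

-- 1/(2c) (only used for c ≥ 1; value at c = 0 is irrelevant)
inv2c : ℕ → ℚ
inv2c zero    = 0ℚ
inv2c (suc c) = (+ 1) / (2 * suc c)

heavy : ∀ {m} → ℕ → (Fin m → ℚ) → Subset m
heavy c γ = Vec.tabulate (λ e → if does (inv2c c ≤? γ e) then inside else outside)

heavyUnion : ∀ {n m} → ℕ → Hypergraph n m → (Fin m → ℚ) → Subset n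
heavyUnion c H γ = Vec.tabulate (λ v →
  if does (anyHeavy v) then inside else outside)
  where
  open import Relation.Nullary using (Dec)
  open import Data.Fin.Properties using (any?)
  open import Data.Product using (∃; _,_)
  open import Relation.Nullary.Decidable using (_×-dec_)
  open import Data.Fin.Subset using (_∈_)
  anyHeavy : ∀ v → Dec (∃ λ e → (e ∈ heavy c γ) × (v ∈ edge H e))
  anyHeavy v = any? (λ e → (e ∈? heavy c γ) ×-dec (v ∈? edge H e))

-- S₀ = {{e} | e heavy}: Σ_{S ∈ S₀} |S| = number of heavy edges
sizeS0 : ∀ {m} → ℕ → (Fin m → ℚ) → ℕ
sizeS0 c γ = ∣ heavy c γ ∣

U0 : ∀ {n m} → ℕ → Hypergraph n m → (Fin m → ℚ) → Subset n
U0 c H γ = B H γ ─ heavyUnion c H γ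

-- n(S₀,U₀) = Σ|S_i| + 2^|U₀|
initSize : ∀ {n m} → ℕ → Hypergraph n m → (Fin m → ℚ) → ℕ
initSize c H γ = sizeS0 c γ +ℕ 2 ^ ∣ U0 c H γ ∣

{-# OPTIONS --safe #-}

-- With ε = 1/(2c), every heavy edge has weight at least ε, so there are at most
-- M = 2c⌈k⌉ of them. A vertex of U₀ lies on no heavy edge, so its load of at least
-- 1 ≥ (c+1)ε comes from the light edges (weight < ε) alone. Let X be a set of vertices
-- each of load at least (j+1)ε from light weights w. Double counting gives
-- ε|X| ≤ Σ_{v∈X} load(v) = Σ_e w(e)|X ∩ e|, and erasing e from w lowers the load of a
-- vertex of X ∩ e by at most ε, so induction on j gives |X ∩ e| ≤ M^(j-1) d and hence
-- |X| ≤ M^j d. At j = 0, X lies in the intersection of the c distinct edges erased on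
-- the way down, which has at most d vertices. Hence |U₀| ≤ M^c d.

module Submission where

open import Defs
open import Data.Nat as ℕ using (ℕ; zero; suc; z≤n; s≤s; _≥_; _^_) renaming (_≤_ to _≤ℕ_)
import Data.Nat.Properties as ℕ
import Data.Integer as ℤ
import Data.Integer.Properties as ℤ
open import Data.Rational using (ℚ; 0ℚ; 1ℚ; mkℚ; _+_; _*_; -_; _/_; 1/_; _≤_; _<_; _≤?_; _<?_; ↥_; *≤*)
open import Data.Rational.Literals using (fromℤ)
import Data.Rational.Properties as ℚ
import Data.Rational.Unnormalised as ℚᵘ
import Data.Rational.Unnormalised.Properties as ℚᵘ
open import Data.Fin using (Fin; zero; suc; _≟_)
open import Data.Fin.Properties using (suc-injective; any?)
open import Data.Fin.Subset using (Subset; inside; outside; _∈_; _∉_; _∩_; _─_; ∣_∣; ⊤)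
open import Data.Fin.Subset.Properties
  using (_∈?_; x∈p∩q⁺; x∈p∩q⁻; ∩-assoc; ∩-identityʳ; p⊆q⇒∣p∣≤∣q∣; p∩q⊆q; p─q⊆p)
open import Data.Vec as Vec using ([]; _∷_; here; there)
open import Data.Vec.Properties using ([]=⇒lookup; lookup⇒[]=; lookup∘tabulate)
import Data.Vec.Functional as Vector
open import Data.Vec.Functional using (Vector; updateAt)
open import Data.Vec.Functional.Properties using (updateAt-updates; updateAt-minimal)
open import Data.Bool using (if_then_else_)
open import Data.Product using (Σ; ∃; _,_; proj₁; proj₂) renaming (_×_ to _×ₚ_)
open import Algebra.Bundles using (CommutativeRing; CommutativeMonoid; Semiring)
open import Level using (0ℓ)
open import Function using (_∘_; const)
open import Function.Definitions using (Injective)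
open import Relation.Nullary using (Dec; yes; no; does; ¬_; contradiction)
open import Relation.Nullary.Decidable using (_×-dec_)
open import Relation.Unary using (Pred; Decidable)
open import Relation.Binary.PropositionalEquality

ℚ-semiring : Semiring 0ℓ 0ℓ
ℚ-semiring = CommutativeRing.semiring ℚ.+-*-commutativeRing

open import Algebra.Properties.Semiring.Sum ℚ-semiring
  using (sum; sum-cong-≗; sum-replicate-zero; ∑-comm; ∑-distrib-+)
open import Algebra.Properties.Semiring.Mult ℚ-semiring
  using (_×_; ×-homo-1; ×-assoc-*; ×-assocˡ)
open import Algebra.Properties.CommutativeSemigroup
  (CommutativeMonoid.commutativeSemigroup ℚ.+-0-commutativeMonoid) using (xy∙z≈zy∙x)

sumFin≡sum : ∀ {m} (g : Vector ℚ m) → sumFin g ≡ sum g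
sumFin≡sum {zero}  g = refl
sumFin≡sum {suc m} g = cong (g zero +_) (sumFin≡sum (g ∘ suc))

sum-mono-≤ : ∀ {m} {g h : Vector ℚ m} → (∀ i → g i ≤ h i) → sum g ≤ sum h
sum-mono-≤ {zero}  _   = ℚ.≤-refl
sum-mono-≤ {suc m} g≤h = ℚ.+-mono-≤ (g≤h zero) (sum-mono-≤ (g≤h ∘ suc))

weight-mono : ∀ {m} {g h : Vector ℚ m} → (∀ i → g i ≤ h i) → weight g ≤ weight h
weight-mono {g = g} {h} g≤h = subst₂ _≤_ (sym (sumFin≡sum g)) (sym (sumFin≡sum h)) (sum-mono-≤ g≤h)

sum-× : ∀ {m} k (g : Vector ℚ m) → sum (λ i → k × g i) ≡ k × sum g
sum-× {m} zero g = sum-replicate-zero m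
sum-× (suc k) g = trans (∑-distrib-+ g (λ i → k × g i)) (cong (sum g +_) (sum-× k g))

sum-agreeExcept : ∀ {m} (e : Fin m) {g h : Vector ℚ m} → (∀ i → i ≢ e → g i ≡ h i) →
                  sum g + h e ≡ sum h + g e
sum-agreeExcept zero {g} {h} g≗h
  rewrite sum-cong-≗ (λ i → g≗h (suc i) (λ ())) = xy∙z≈zy∙x (g zero) (sum (h ∘ suc)) (h zero)
sum-agreeExcept (suc e) {g} {h} g≗h = begin
  g zero + sum (g ∘ suc) + h (suc e)   ≡⟨ ℚ.+-assoc (g zero) _ _ ⟩
  g zero + (sum (g ∘ suc) + h (suc e)) ≡⟨ cong₂ _+_ (g≗h zero (λ ())) (sum-agreeExcept e g∘suc≗h∘suc) ⟩
  h zero + (sum (h ∘ suc) + g (suc e)) ≡⟨ ℚ.+-assoc (h zero) _ _ ⟨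
  h zero + sum (h ∘ suc) + g (suc e)   ∎
  where
  open ≡-Reasoning
  g∘suc≗h∘suc : ∀ i → i ≢ e → g (suc i) ≡ h (suc i)
  g∘suc≗h∘suc i i≢e = g≗h (suc i) (i≢e ∘ suc-injective)

infixr 8 [_∈_]·_

[_∈_]·_ : ∀ {n} → Fin n → Subset n → ℚ → ℚ
[ v ∈ X ]· q = if does (v ∈? X) then q else 0ℚ

[∈]·-≤ : ∀ {n} (v : Fin n) X {q} → 0ℚ ≤ q → [ v ∈ X ]· q ≤ q
[∈]·-≤ v X q≥0 with v ∈? X
... | yes _ = ℚ.≤-refl
... | no  _ = q≥0

[∈]·-mono : ∀ {n} (v : Fin n) X {p q} → (v ∈ X → p ≤ q) → [ v ∈ X ]· p ≤ [ v ∈ X ]· q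
[∈]·-mono v X p≤q with v ∈? X
... | yes v∈X = p≤q v∈X
... | no  _   = ℚ.≤-refl

[∈]·-sum : ∀ {n m} (v : Fin n) X (g : Vector ℚ m) → [ v ∈ X ]· sum g ≡ sum (λ i → [ v ∈ X ]· g i)
[∈]·-sum {m = m} v X g with v ∈? X
... | yes _ = refl
... | no  _ = sym (sum-replicate-zero m)

[∈]·-∩ : ∀ {n} (v : Fin n) X Y q → [ v ∈ X ]· [ v ∈ Y ]· q ≡ [ v ∈ X ∩ Y ]· q
[∈]·-∩ v X Y q with v ∈? X | v ∈? Y | v ∈? X ∩ Y
... | yes v∈X | yes v∈Y | no v∉X∩Y = contradiction (x∈p∩q⁺ (v∈X , v∈Y)) v∉X∩Y
... | yes _   | no v∉Y  | yes v∈X∩Y = contradiction (proj₂ (x∈p∩q⁻ X Y v∈X∩Y)) v∉Y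
... | no v∉X  | _       | yes v∈X∩Y = contradiction (proj₁ (x∈p∩q⁻ X Y v∈X∩Y)) v∉X
... | yes _   | yes _   | yes _ = refl
... | yes _   | no _    | no _  = refl
... | no _    | _       | no _  = refl

sum-[∈]· : ∀ {n} (X : Subset n) q → sum (λ v → [ v ∈ X ]· q) ≡ ∣ X ∣ × q
sum-[∈]· []            q = refl
sum-[∈]· (inside  ∷ X) q = cong (q +_) (sum-[∈]· X q)
sum-[∈]· (outside ∷ X) q = trans (ℚ.+-identityˡ _) (sum-[∈]· X q)

∣X∣×q≤sum : ∀ {n} (X : Subset n) {q} {g : Vector ℚ n} → (∀ {v} → v ∈ X → q ≤ g v) →
            ∣ X ∣ × q ≤ sum (λ v → [ v ∈ X ]· g v)
∣X∣×q≤sum X {q} q≤g = subst (_≤ _) (sum-[∈]· X q) (sum-mono-≤ (λ v → [∈]·-mono v X q≤g))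

×-zeroʳ : ∀ k → k × 0ℚ ≡ 0ℚ
×-zeroʳ zero    = refl
×-zeroʳ (suc k) = trans (ℚ.+-identityˡ _) (×-zeroʳ k)

×-nonNeg : ∀ {x} → 0ℚ ≤ x → ∀ k → 0ℚ ≤ k × x
×-nonNeg x≥0 zero    = ℚ.≤-refl
×-nonNeg x≥0 (suc k) = ℚ.+-mono-≤ x≥0 (×-nonNeg x≥0 k)

×-monoˡ-≤ : ∀ {x k l} → 0ℚ ≤ x → k ≤ℕ l → k × x ≤ l × x
×-monoˡ-≤ {x} x≥0 (z≤n {l}) = ×-nonNeg x≥0 l
×-monoˡ-≤ {x} x≥0 (s≤s k≤l) = ℚ.+-monoʳ-≤ x (×-monoˡ-≤ x≥0 k≤l)

×-monoʳ-≤ : ∀ k {x y} → x ≤ y → k × x ≤ k × y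
×-monoʳ-≤ zero    _   = ℚ.≤-refl
×-monoʳ-≤ (suc k) x≤y = ℚ.+-mono-≤ x≤y (×-monoʳ-≤ k x≤y)

×-monoˡ-< : ∀ {x k l} → 0ℚ < x → k ℕ.< l → k × x < l × x
×-monoˡ-< {x} {k} x>0 k<l = ℚ.<-≤-trans k×x<x+k×x (×-monoˡ-≤ (ℚ.<⇒≤ x>0) k<l)
  where
  k×x<x+k×x : k × x < x + k × x
  k×x<x+k×x = subst (_< x + k × x) (ℚ.+-identityˡ (k × x)) (ℚ.+-monoˡ-< (k × x) x>0)

×-cancelʳ-≤ : ∀ {x k l} → 0ℚ < x → k × x ≤ l × x → k ≤ℕ l
×-cancelʳ-≤ x>0 kx≤lx = ℕ.≮⇒≥ (λ l<k → ℚ.<-irrefl refl (ℚ.<-≤-trans (×-monoˡ-< x>0 l<k) kx≤lx))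

+-cancelˡ-≤ : ∀ r {p q} → r + p ≤ r + q → p ≤ q
+-cancelˡ-≤ r {p} {q} r+p≤r+q = begin
  p             ≡⟨ -r+[r+x]≡x p ⟨
  - r + (r + p) ≤⟨ ℚ.+-monoʳ-≤ (- r) r+p≤r+q ⟩
  - r + (r + q) ≡⟨ -r+[r+x]≡x q ⟩
  q             ∎
  where
  open ℚ.≤-Reasoning
  -r+[r+x]≡x : ∀ x → - r + (r + x) ≡ x
  -r+[r+x]≡x x = trans (sym (ℚ.+-assoc (- r) r x)) (trans (cong (_+ x) (ℚ.+-inverseˡ r)) (ℚ.+-identityˡ x))

×1ℚ≡fromℤ : ∀ k → k × 1ℚ ≡ fromℤ (ℤ.+ k)
×1ℚ≡fromℤ zero    = refl
×1ℚ≡fromℤ (suc k) = trans (cong (1ℚ +_) (×1ℚ≡fromℤ k)) (sym fromℤ-suc)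
  where
  eq : (ℤ.+ 1 ℤ.* ℤ.+ 1 ℤ.+ ℤ.+ k ℤ.* ℤ.+ 1) ℤ.* ℤ.+ 1 ≡ ℤ.+ suc k ℤ.* (ℤ.+ 1 ℤ.* ℤ.+ 1)
  eq = trans (ℤ.*-identityʳ _) (trans (cong (ℤ._+_ (ℤ.+ 1)) (ℤ.*-identityʳ (ℤ.+ k))) (sym (ℤ.*-identityʳ (ℤ.+ suc k))))
  fromℤ-suc : fromℤ (ℤ.+ suc k) ≡ 1ℚ + fromℤ (ℤ.+ k)
  fromℤ-suc = ℚ.toℚᵘ-injective (ℚᵘ.≃-sym (ℚᵘ.≃-trans (ℚ.toℚᵘ-homo-+ 1ℚ (fromℤ (ℤ.+ k))) (ℚᵘ.*≡* eq)))

n×1/n≡1 : ∀ n .{{_ : ℕ.NonZero n}} → n × (ℤ.+ 1 / n) ≡ 1ℚ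
n×1/n≡1 (suc n) = begin
  suc n × (ℤ.+ 1 / suc n)                  ≡⟨ cong (suc n ×_) (ℚ.*-identityˡ (ℤ.+ 1 / suc n)) ⟨
  suc n × (1ℚ * (ℤ.+ 1 / suc n))           ≡⟨ ×-assoc-* (suc n) 1ℚ _ ⟨
  (suc n × 1ℚ) * (ℤ.+ 1 / suc n)           ≡⟨ cong₂ _*_ (×1ℚ≡fromℤ (suc n)) 1/suc-n≡1/fromℤ ⟩
  fromℤ (ℤ.+ suc n) * 1/ fromℤ (ℤ.+ suc n) ≡⟨ ℚ.*-inverseʳ (fromℤ (ℤ.+ suc n)) ⟩
  1ℚ                                       ∎
  where
  open ≡-Reasoning
  1/suc-n≡1/fromℤ : ℤ.+ 1 / suc n ≡ 1/ fromℤ (ℤ.+ suc n)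
  1/suc-n≡1/fromℤ = ℚ.toℚᵘ-injective (ℚ.toℚᵘ-fromℚᵘ (ℚᵘ.mkℚᵘ (ℤ.+ 1) n))

1/n>0 : ∀ n .{{_ : ℕ.NonZero n}} → 0ℚ < ℤ.+ 1 / n
1/n>0 n = ℚ.positive⁻¹ _ {{ℚ.normalize-pos 1 n}}

≤∣↥∣×1ℚ : ∀ p → p ≤ ℤ.∣ ↥ p ∣ × 1ℚ
≤∣↥∣×1ℚ p = subst (p ≤_) (sym (×1ℚ≡fromℤ _)) (≤fromℤ∣↥∣ p)
  where
  ≤fromℤ∣↥∣ : ∀ p → p ≤ fromℤ (ℤ.+ ℤ.∣ ↥ p ∣)
  ≤fromℤ∣↥∣ (mkℚ (ℤ.+ a) d _) = *≤* (subst₂ ℤ._≤_ (sym (ℤ.*-identityʳ (ℤ.+ a))) (ℤ.pos-* a (suc d))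
                                       (ℤ.+≤+ (ℕ.m≤m*n a (suc d))))
  ≤fromℤ∣↥∣ (mkℚ ℤ.-[1+ a ] d _) = *≤* ℤ.-≤+

≤∣↥∣*n×1/n : ∀ p n .{{_ : ℕ.NonZero n}} → p ≤ (ℤ.∣ ↥ p ∣ ℕ.* n) × (ℤ.+ 1 / n)
≤∣↥∣*n×1/n p n = begin
  p                            ≤⟨ ≤∣↥∣×1ℚ p ⟩
  K × 1ℚ                       ≡⟨ cong (K ×_) (n×1/n≡1 n) ⟨
  K × (n × (ℤ.+ 1 / n))        ≡⟨ ×-assocˡ _ K n ⟩
  (K ℕ.* n) × (ℤ.+ 1 / n)      ∎
  where
  open ℚ.≤-Reasoning
  K : ℕ
  K = ℤ.∣ ↥ p ∣

if-does : ∀ {a p} {A : Set a} {P : Set p} (R : A → Set) (d : Dec P) {x y} →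
          (P → R x) → (¬ P → R y) → R (if does d then x else y)
if-does R (yes p) on-yes _ = on-yes p
if-does R (no ¬p) _ on-no  = on-no ¬p

∷-injective : ∀ {k m} {x : Fin m} {f : Fin k → Fin m} → (∀ i → f i ≢ x) →
              Injective _≡_ _≡_ f → Injective _≡_ _≡_ (x Vector.∷ f)
∷-injective f≢x f-inj {zero}  {zero}  _     = refl
∷-injective f≢x f-inj {zero}  {suc j} x≡fj  = contradiction (sym x≡fj) (f≢x j)
∷-injective f≢x f-inj {suc i} {zero}  fi≡x  = contradiction fi≡x (f≢x i)
∷-injective f≢x f-inj {suc i} {suc j} fi≡fj = cong suc (f-inj fi≡fj)

x∈p─q⇒x∉q : ∀ {n} (p q : Subset n) {x} → x ∈ p ─ q → x ∉ q
x∈p─q⇒x∉q (inside ∷ p) (outside ∷ q) here ()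
x∈p─q⇒x∉q (_ ∷ p) (_ ∷ q) (there x∈p─q) (there x∈q) = x∈p─q⇒x∉q p q x∈p─q x∈q

module _ {n} {P : Pred (Fin n) 0ℓ} (P? : Decidable P) where

  private
    S : Subset n
    S = Vec.tabulate (λ i → if does (P? i) then inside else outside)

  ∈-tabulate⁺ : ∀ {i} → P i → i ∈ S
  ∈-tabulate⁺ {i} Pi = lookup⇒[]= i S (trans (lookup∘tabulate _ i)
    (if-does (_≡ inside) (P? i) (λ _ → refl) (contradiction Pi)))

  ∈-tabulate⁻ : ∀ {i} → i ∈ S → P i
  ∈-tabulate⁻ {i} i∈S = if-does (λ b → b ≡ inside → P i) (P? i) (λ Pi _ → Pi) (λ _ ())
    (trans (sym (lookup∘tabulate _ i)) ([]=⇒lookup i∈S))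

erase : ∀ {m} → Fin m → Vector ℚ m → Vector ℚ m
erase e w = updateAt w e (const 0ℚ)

erase-nonNeg : ∀ {m} e {w : Vector ℚ m} → (∀ i → 0ℚ ≤ w i) → ∀ i → 0ℚ ≤ erase e w i
erase-nonNeg e {w} w≥0 i with i ≟ e
... | yes refl = ℚ.≤-reflexive (sym (updateAt-updates e w))
... | no  i≢e  = subst (0ℚ ≤_) (sym (updateAt-minimal i e w i≢e)) (w≥0 i)

erase-≤ : ∀ {m} e {w : Vector ℚ m} → (∀ i → 0ℚ ≤ w i) → ∀ i → erase e w i ≤ w i
erase-≤ e {w} w≥0 i with i ≟ e
... | yes refl = subst (_≤ w e) (sym (updateAt-updates e w)) (w≥0 e)
... | no  i≢e  = ℚ.≤-reflexive (updateAt-minimal i e w i≢e)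

-- Vertices of large load

module _ {n m} (H : Hypergraph n m) where

  -- Restricting f to edges of positive weight keeps an erased edge from being chosen again.
  IsCDWithin : ℕ → ℕ → Subset n → Vector ℚ m → Set
  IsCDWithin j d X w = (f : Fin j → Fin m) → Injective _≡_ _≡_ f → (∀ i → 0ℚ < w (f i)) →
                       ∣ X ∩ common H f ∣ ≤ℕ d

  IsCD⇒IsCDWithin : ∀ {j d} X w → IsCD j d H → IsCDWithin j d X w
  IsCD⇒IsCDWithin X w cd f f-inj _ = ℕ.≤-trans (p⊆q⇒∣p∣≤∣q∣ (p∩q⊆q X (common H f))) (cd f f-inj)

  IsCDWithin-erase : ∀ {j d} X w {e} → IsCDWithin (suc j) d X w → 0ℚ < w e →
                     IsCDWithin j d (X ∩ edge H e) (erase e w)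
  IsCDWithin-erase {d = d} X w {e} cd we>0 f f-inj f>0 =
    subst (λ Y → ∣ Y ∣ ≤ℕ d) (sym (∩-assoc X (edge H e) (common H f)))
      (cd (e Vector.∷ f) (∷-injective f≢e f-inj) e∷f>0)
    where
    f≢e : ∀ i → f i ≢ e
    f≢e i fi≡e = ℚ.<-irrefl (trans (sym (updateAt-updates e w)) (cong (erase e w) (sym fi≡e))) (f>0 i)
    e∷f>0 : ∀ i → 0ℚ < w ((e Vector.∷ f) i)
    e∷f>0 zero    = we>0
    e∷f>0 (suc i) = subst (0ℚ <_) (updateAt-minimal (f i) e w (f≢e i)) (f>0 i)

  load≤we+load-erase : ∀ w e v → 0ℚ ≤ w e → load H w v ≤ w e + load H (erase e w) v
  load≤we+load-erase w e v we≥0 = begin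
    load H w v                  ≡⟨ sumFin≡sum g ⟩
    sum g                       ≡⟨ ℚ.+-identityʳ (sum g) ⟨
    sum g + 0ℚ                  ≡⟨ cong (sum g +_) g′e≡0 ⟨
    sum g + g′ e                ≡⟨ sum-agreeExcept e g≗g′ ⟩
    sum g′ + g e                ≡⟨ ℚ.+-comm (sum g′) (g e) ⟩
    g e + sum g′                ≤⟨ ℚ.+-monoˡ-≤ (sum g′) ([∈]·-≤ v (edge H e) we≥0) ⟩
    w e + sum g′                ≡⟨ cong (w e +_) (sumFin≡sum g′) ⟨
    w e + load H (erase e w) v  ∎
    where
    open ℚ.≤-Reasoning
    g : Vector ℚ m
    g i = [ v ∈ edge H i ]· w i
    g′ : Vector ℚ m
    g′ i = [ v ∈ edge H i ]· erase e w i
    g′e≡0 : g′ e ≡ 0ℚ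
    g′e≡0 = trans (cong ([ v ∈ edge H e ]·_) (updateAt-updates e w))
                  (if-does (_≡ 0ℚ) (v ∈? edge H e) (λ _ → refl) (λ _ → refl))
    g≗g′ : ∀ i → i ≢ e → g i ≡ g′ i
    g≗g′ i i≢e = cong ([ v ∈ edge H i ]·_) (sym (updateAt-minimal i e w i≢e))

  sum-load : ∀ X w → sum (λ v → [ v ∈ X ]· load H w v) ≡ sum (λ e → ∣ X ∩ edge H e ∣ × w e)
  sum-load X w = begin
    sum (λ v → [ v ∈ X ]· load H w v)
      ≡⟨ sum-cong-≗ (λ v → trans (cong ([ v ∈ X ]·_) (sumFin≡sum (incident v))) ([∈]·-sum v X (incident v))) ⟩
    sum (λ v → sum (λ e → [ v ∈ X ]· [ v ∈ edge H e ]· w e))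
      ≡⟨ sum-cong-≗ (λ v → sum-cong-≗ (λ e → [∈]·-∩ v X (edge H e) (w e))) ⟩
    sum (λ v → sum (λ e → [ v ∈ X ∩ edge H e ]· w e))
      ≡⟨ ∑-comm (λ v e → [ v ∈ X ∩ edge H e ]· w e) ⟩
    sum (λ e → sum (λ v → [ v ∈ X ∩ edge H e ]· w e))
      ≡⟨ sum-cong-≗ (λ e → sum-[∈]· (X ∩ edge H e) (w e)) ⟩
    sum (λ e → ∣ X ∩ edge H e ∣ × w e)
      ∎
    where
    open ≡-Reasoning
    incident : Fin n → Vector ℚ m
    incident v e = [ v ∈ edge H e ]· w e

  ∣loaded∣≤ : ∀ {ε} → 0ℚ < ε → ∀ M d j (X : Subset n) (w : Vector ℚ m) →
              (∀ e → 0ℚ ≤ w e) → (∀ e → w e ≤ ε) → weight w ≤ M × ε → IsCDWithin j d X w →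
              (∀ {v} → v ∈ X → suc j × ε ≤ load H w v) → ∣ X ∣ ≤ℕ M ^ j ℕ.* d
  ∣loaded∣≤ ε>0 M d zero X w _ _ _ cd _ = begin
    ∣ X ∣     ≡⟨ cong ∣_∣ (∩-identityʳ X) ⟨
    ∣ X ∩ ⊤ ∣ ≤⟨ cd (λ ()) (λ { {()} }) (λ ()) ⟩
    d         ≡⟨ ℕ.*-identityˡ d ⟨
    1 ℕ.* d   ∎
    where open ℕ.≤-Reasoning
  ∣loaded∣≤ {ε} ε>0 M d (suc j) X w w≥0 w≤ε w≤Mε cd loaded = ×-cancelʳ-≤ ε>0 (begin
    ∣ X ∣ × ε                           ≤⟨ ∣X∣×q≤sum X ε≤load ⟩
    sum (λ v → [ v ∈ X ]· load H w v)   ≡⟨ sum-load X w ⟩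
    sum (λ e → ∣ X ∩ edge H e ∣ × w e)  ≤⟨ sum-mono-≤ ∣X∩e∣×we≤ ⟩
    sum (λ e → F × w e)                 ≡⟨ sum-× F w ⟩
    F × sum w                           ≤⟨ ×-monoʳ-≤ F (subst (_≤ M × ε) (sumFin≡sum w) w≤Mε) ⟩
    F × (M × ε)                         ≡⟨ ×-assocˡ ε F M ⟩
    (F ℕ.* M) × ε                       ≡⟨ cong (_× ε) F*M≡ ⟩
    (M ^ suc j ℕ.* d) × ε               ∎)
    where
    open ℚ.≤-Reasoning
    F : ℕ
    F = M ^ j ℕ.* d
    F*M≡ : F ℕ.* M ≡ M ^ suc j ℕ.* d
    F*M≡ = trans (ℕ.*-comm F M) (sym (ℕ.*-assoc M (M ^ j) d))
    ε≤load : ∀ {v} → v ∈ X → ε ≤ load H w v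
    ε≤load {v} v∈X = begin
      ε                   ≡⟨ ×-homo-1 ε ⟨
      1 × ε               ≤⟨ ×-monoˡ-≤ {k = 1} {suc (suc j)} (ℚ.<⇒≤ ε>0) (s≤s z≤n) ⟩
      suc (suc j) × ε     ≤⟨ loaded v∈X ⟩
      load H w v          ∎
    erase-loaded : ∀ e {v} → v ∈ X ∩ edge H e → suc j × ε ≤ load H (erase e w) v
    erase-loaded e {v} v∈X∩e = +-cancelˡ-≤ ε (begin
      ε + suc j × ε               ≤⟨ loaded (proj₁ (x∈p∩q⁻ X (edge H e) v∈X∩e)) ⟩
      load H w v                  ≤⟨ load≤we+load-erase w e v (w≥0 e) ⟩
      w e + load H (erase e w) v  ≤⟨ ℚ.+-monoˡ-≤ (load H (erase e w) v) (w≤ε e) ⟩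
      ε + load H (erase e w) v    ∎)
    ∣X∩e∣×we≤ : ∀ e → ∣ X ∩ edge H e ∣ × w e ≤ F × w e
    ∣X∩e∣×we≤ e with 0ℚ <? w e
    ... | yes we>0 = ×-monoˡ-≤ (w≥0 e) (∣loaded∣≤ ε>0 M d j (X ∩ edge H e) (erase e w)
                       (erase-nonNeg e w≥0) (λ i → ℚ.≤-trans (erase-≤ e w≥0 i) (w≤ε i))
                       (ℚ.≤-trans (weight-mono (erase-≤ e w≥0)) w≤Mε)
                       (IsCDWithin-erase X w cd we>0) (erase-loaded e))
    ... | no  we≯0 rewrite ℚ.≤-antisym (ℚ.≮⇒≥ we≯0) (w≥0 e) =
                     ℚ.≤-reflexive (trans (×-zeroʳ ∣ X ∩ edge H e ∣) (sym (×-zeroʳ F)))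

-- The initial pair

inv2c-nonNeg : ∀ c → 0ℚ ≤ inv2c c
inv2c-nonNeg zero    = ℚ.≤-refl
inv2c-nonNeg (suc c) = ℚ.<⇒≤ (1/n>0 (2 ℕ.* suc c))

light : ∀ {m} → ℕ → Vector ℚ m → Vector ℚ m
light c γ e = if does (inv2c c ≤? γ e) then 0ℚ else γ e

module _ (c : ℕ) {m} (γ : Vector ℚ m) (γ≥0 : ∀ e → 0ℚ ≤ γ e) where

  private
    ε : ℚ
    ε = inv2c c

  light-nonNeg : ∀ e → 0ℚ ≤ light c γ e
  light-nonNeg e = if-does (0ℚ ≤_) (ε ≤? γ e) (λ _ → ℚ.≤-refl) (λ _ → γ≥0 e)

  light-≤-inv2c : ∀ e → light c γ e ≤ ε
  light-≤-inv2c e = if-does (_≤ ε) (ε ≤? γ e) (λ _ → inv2c-nonNeg c) (ℚ.<⇒≤ ∘ ℚ.≰⇒>)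

  light-≤ : ∀ e → light c γ e ≤ γ e
  light-≤ e = if-does (_≤ γ e) (ε ≤? γ e) (λ _ → γ≥0 e) (λ _ → ℚ.≤-refl)

  ∣heavy∣×inv2c≤weight : ∣ heavy c γ ∣ × ε ≤ weight γ
  ∣heavy∣×inv2c≤weight = begin
    ∣ heavy c γ ∣ × ε                       ≤⟨ ∣X∣×q≤sum (heavy c γ) (∈-tabulate⁻ (λ e → ε ≤? γ e)) ⟩
    sum (λ e → [ e ∈ heavy c γ ]· γ e)      ≤⟨ sum-mono-≤ (λ e → [∈]·-≤ e (heavy c γ) (γ≥0 e)) ⟩
    sum γ                                   ≡⟨ sumFin≡sum γ ⟨
    weight γ                                ∎
    where open ℚ.≤-Reasoning

  module _ {n} (H : Hypergraph n m) where

    load-light : ∀ {v} → v ∉ heavyUnion c H γ → load H (light c γ) v ≡ load H γ v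
    load-light {v} v∉⋃ = begin
      load H (light c γ) v                          ≡⟨ sumFin≡sum (λ e → [ v ∈ edge H e ]· light c γ e) ⟩
      sum (λ e → [ v ∈ edge H e ]· light c γ e)      ≡⟨ sum-cong-≗ light-agrees ⟩
      sum (λ e → [ v ∈ edge H e ]· γ e)              ≡⟨ sumFin≡sum (λ e → [ v ∈ edge H e ]· γ e) ⟨
      load H γ v                                    ∎
      where
      open ≡-Reasoning
      heavyIncident? : Decidable (λ u → ∃ λ e → e ∈ heavy c γ ×ₚ u ∈ edge H e)
      heavyIncident? u = any? (λ e → (e ∈? heavy c γ) ×-dec (u ∈? edge H e))
      light-agrees : ∀ e → [ v ∈ edge H e ]· light c γ e ≡ [ v ∈ edge H e ]· γ e
      light-agrees e with v ∈? edge H e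
      ... | no  _   = refl
      ... | yes v∈e = if-does (_≡ γ e) (ε ≤? γ e) (λ ε≤γ → contradiction (v∈⋃ ε≤γ) v∉⋃) (λ _ → refl)
        where
        v∈⋃ : ε ≤ γ e → v ∈ heavyUnion c H γ
        v∈⋃ ε≤γ = ∈-tabulate⁺ heavyIncident? (e , ∈-tabulate⁺ (λ e → ε ≤? γ e) ε≤γ , v∈e)

-- ∣ ↥ k ∣ plays the role of ⌈k⌉: any natural number above k would do.
heavyBound : ℚ → ℕ → ℕ
heavyBound k c = ℤ.∣ ↥ k ∣ ℕ.* (2 ℕ.* c)

init : ℕ → ℕ → ℚ → ℕ
init c d k = heavyBound k c ℕ.+ 2 ^ (heavyBound k c ^ c ℕ.* d)

module _ (c : ℕ) {m} (γ : Vector ℚ m) (γ≥0 : ∀ e → 0ℚ ≤ γ e) (k : ℚ) (weight≤k : weight γ ≤ k) where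

  private
    ε : ℚ
    ε = inv2c (suc c)
    M : ℕ
    M = heavyBound k (suc c)

  weight≤M×inv2c : weight γ ≤ M × ε
  weight≤M×inv2c = ℚ.≤-trans weight≤k (≤∣↥∣*n×1/n k (2 ℕ.* suc c))

  ∣heavy∣≤heavyBound : ∣ heavy (suc c) γ ∣ ≤ℕ M
  ∣heavy∣≤heavyBound = ×-cancelʳ-≤ (1/n>0 (2 ℕ.* suc c))
    (ℚ.≤-trans (∣heavy∣×inv2c≤weight (suc c) γ γ≥0) weight≤M×inv2c)

  ∣U0∣≤ : ∀ {n} d (H : Hypergraph n m) → IsCD (suc c) d H → ∣ U0 (suc c) H γ ∣ ≤ℕ M ^ suc c ℕ.* d
  ∣U0∣≤ {n} d H cd = ∣loaded∣≤ H (1/n>0 (2 ℕ.* suc c)) M d (suc c) U (light (suc c) γ)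
    (light-nonNeg (suc c) γ γ≥0) (light-≤-inv2c (suc c) γ γ≥0)
    (ℚ.≤-trans (weight-mono (light-≤ (suc c) γ γ≥0)) weight≤M×inv2c)
    (IsCD⇒IsCDWithin H U (light (suc c) γ) cd) loaded
    where
    U : Subset n
    U = U0 (suc c) H γ
    loaded : ∀ {v} → v ∈ U → suc (suc c) × ε ≤ load H (light (suc c) γ) v
    loaded {v} v∈U = begin
      suc (suc c) × ε              ≤⟨ ×-monoˡ-≤ (inv2c-nonNeg (suc c)) c+2≤2c+2 ⟩
      (2 ℕ.* suc c) × ε            ≡⟨ n×1/n≡1 (2 ℕ.* suc c) ⟩
      1ℚ                           ≤⟨ ∈-tabulate⁻ (λ u → 1ℚ ≤? load H γ u) (p─q⊆p _ _ v∈U) ⟩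
      load H γ v                   ≡⟨ load-light (suc c) γ γ≥0 H (x∈p─q⇒x∉q (B H γ) _ v∈U) ⟨
      load H (light (suc c) γ) v   ∎
      where
      open ℚ.≤-Reasoning
      c+2≤2c+2 : suc (suc c) ≤ℕ 2 ℕ.* suc c
      c+2≤2c+2 = s≤s (ℕ.≤-trans (ℕ.m≤n+m (suc c) c) (ℕ.+-monoʳ-≤ c (ℕ.m≤m+n (suc c) 0)))

lemma3p5 : Σ (ℕ → ℕ → ℚ → ℕ) λ init →
    (c d : ℕ) → c ≥ 1 → (k : ℚ) →
    {n m : ℕ} (H : Hypergraph n m) → IsCD c d H →
    (γ : Fin m → ℚ) → IsFractional γ → weight γ ≤ k →
    initSize c H γ ≤ℕ init c d k
lemma3p5 = init , λ where
  (suc c) d _ k H cd γ fractional weight≤k →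
    let γ≥0 = proj₁ ∘ fractional in
    ℕ.+-mono-≤ (∣heavy∣≤heavyBound c γ γ≥0 k weight≤k)
               (ℕ.^-monoʳ-≤ 2 (∣U0∣≤ c γ γ≥0 k weight≤k d H cd))
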